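{- Let $D=L\rightarrow R$, where $L$ and $R$ are two oriented graphs with $\operatorname{inv}(L) = \operatorname{inv}(R) = 1$. Then for any decycling family $(X_1, X_2)$ of $D$ (of two sets), either $X_1\subset V(L)$ and $X_2\subset V(R)$, or $X_1\subset V(R)$ and $X_2\subset V(L)$.
   Context: An oriented graph is a digraph with no loops, no multiple arcs and no directed cycle of length 2. Inverting a vertex set $X$ means reversing every arc with both ends in $X$. A decycling family of $D$ is a family of subsets of $V(D)$ such that inverting them successively yields an acyclic digraph (an arc is reversed iff an odd number of the sets contain both its ends). $\operatorname{inv}(D)$ is the minimum size of a decycling family. The dijoin $L\rightarrow R$ is obtained from the disjoint union of $L$ and $R$ by adding all arcs from $V(L)$ to $V(R)$. -}

module Defs where

open import Data.Nat using (ℕ; _+_; _≥_)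
open import Data.Fin using (Fin; _↑ˡ_; _↑ʳ_; splitAt)
open import Data.Fin.Subset using (Subset; _∈_)
open import Data.Bool using (Bool; true; false; _∧_; _xor_; not; _∨_)
open import Data.Vec using (lookup)
open import Data.List using (List; []; _∷_; length; foldr)
open import Data.Sum using (inj₁; inj₂)
open import Data.Product using (Σ; _×_)
open import Relation.Binary.PropositionalEquality using (_≡_)
open import Relation.Nullary using (¬_)

Digraph : ℕ → Set
Digraph n = Fin n → Fin n → Bool

-- Oriented graph: no loops and no directed 2-cycle (multiple arcs are
-- impossible in this representation).
Oriented : {n : ℕ} → Digraph n → Set
Oriented {n} A = ((u : Fin n) → A u u ≡ false)
               × ((u v : Fin n) → A u v ≡ true → A v u ≡ false)

data Walk {n : ℕ} (A : Digraph n) : Fin n → Fin n → Set where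
  arc  : ∀ {u v} → A u v ≡ true → Walk A u v
  _∷ʷ_ : ∀ {u v w} → A u v ≡ true → Walk A v w → Walk A u w

Acyclic : {n : ℕ} → Digraph n → Set
Acyclic {n} A = (v : Fin n) → ¬ Walk A v v

flipped : {n : ℕ} → List (Subset n) → Fin n → Fin n → Bool
flipped F u v = foldr (λ X b → (lookup X u ∧ lookup X v) xor b) false F

-- The digraph obtained by inverting the sets of F successively:
-- an arc is reversed iff an odd number of sets contain both its ends.
invert : {n : ℕ} → Digraph n → List (Subset n) → Digraph n
invert A F u v = (A u v ∧ not (flipped F u v)) ∨ (A v u ∧ flipped F v u)

Decycling : {n : ℕ} → Digraph n → List (Subset n) → Set
Decycling A F = Acyclic (invert A F)

InvEq : {n : ℕ} → Digraph n → ℕ → Set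
InvEq {n} A k = Σ (List (Subset n)) (λ F → length F ≡ k × Decycling A F)
              × ((F : List (Subset n)) → Decycling A F → length F ≥ k)

-- The dijoin L → R on vertex set Fin (m + n): first m vertices are V(L),
-- last n vertices are V(R).
dijoin : {m n : ℕ} → Digraph m → Digraph n → Digraph (m + n)
dijoin {m} {n} L R x y with splitAt m x | splitAt m y
... | inj₁ i | inj₁ j = L i j
... | inj₂ i | inj₂ j = R i j
... | inj₁ _ | inj₂ _ = true
... | inj₂ _ | inj₁ _ = false

⊆VL : (m n : ℕ) → Subset (m + n) → Set
⊆VL m n X = ∀ x → x ∈ X → Σ (Fin m) (λ i → x ≡ i ↑ˡ n)

⊆VR : (m n : ℕ) → Subset (m + n) → Set
⊆VR m n X = ∀ x → x ∈ X → Σ (Fin n) (λ j → x ≡ m ↑ʳ j)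

-- Give every vertex its type (x ∈ X₁ , x ∈ X₂) ∈ 𝔽₂²: an arc is reversed exactly when the
-- dot product of the types of its ends is 1. Acyclicity of the inverted dijoin then forbids
-- two local patterns: an alternating 4-cycle between V(L) and V(R), and a transitive
-- triangle whose two path arcs are reversed alike while its shortcut is not. What remains
-- depends only on which types occur in L and in R, and a finite check of all 2⁴ × 2⁴ cases
-- shows that these either have the claimed shape, contain an alternating 4-cycle, or admit
-- a layering of the types along which every arc of L (or of R) rises weakly, with the arcs
-- inside a layer uniformly kept or uniformly reversed. In the last case a cycle of L (or R)
-- would survive the inversion, i.e. inv(L) = 0 (or inv(R) = 0).
module Submission where

open import Defs
open import Data.Bool using (Bool; true; false; T; not; _∧_; _xor_)
open import Data.Bool.Properties using (∨-zeroʳ; xor-identityʳ; ¬-not) renaming (_≟_ to _≟ᵇ_)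
open import Data.Empty using (⊥; ⊥-elim)
open import Data.Fin using (Fin; _↑ˡ_; _↑ʳ_; splitAt)
open import Data.Fin.Properties using (splitAt-↑ˡ; splitAt-↑ʳ; splitAt⁻¹-↑ˡ; splitAt⁻¹-↑ʳ; any?)
open import Data.Fin.Subset using (Subset; _∈_; _∉_)
open import Data.List using (List; _∷_; [])
open import Data.Nat using (ℕ; zero; suc; _+_; _≤_; _≤?_)
open import Data.Nat.Properties using (≤-refl; ≤-trans; ≤-antisym) renaming (_≟_ to _≟ⁿ_)
open import Data.Product using (_×_; ∃; ∃-syntax; _,_; proj₁; proj₂; swap)
open import Data.Product.Properties using (≡-dec)
open import Data.Sum using (_⊎_; inj₁; inj₂; [_,_])
open import Data.Vec using (lookup)
open import Data.Vec.Properties using ([]=⇒lookup)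
open import Function using (_∘_; case_of_)
open import Relation.Binary.PropositionalEquality
  using (_≡_; refl; sym; trans; cong; subst; module ≡-Reasoning)
open import Relation.Nullary using (Dec; yes; no; ¬_)
open import Relation.Nullary.Decidable
  using (map′; _×-dec_; _⊎-dec_; _→-dec_; T?; isYes; from-yes; toWitness; fromWitness)

private
  variable
    k l : ℕ
    u v w x y z : Fin k

transpose : Digraph k → Digraph k
transpose A u v = A v u

orient : Bool → Digraph k → Digraph k
orient false A = A
orient true  A = transpose A

orient-not : ∀ b {A : Digraph k} → orient (not b) A u v ≡ true → orient b A v u ≡ true
orient-not false e = e
orient-not true  e = e

_++ʷ_ : {A : Digraph k} → Walk A u v → Walk A v w → Walk A u w
arc e    ++ʷ W′ = e ∷ʷ W′
(e ∷ʷ W) ++ʷ W′ = e ∷ʷ (W ++ʷ W′)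

reverseʷ : {A : Digraph k} → Walk (transpose A) u v → Walk A v u
reverseʷ (arc e)  = arc e
reverseʷ (e ∷ʷ W) = reverseʷ W ++ʷ arc e

mapʷ : {A B : Digraph k} → (∀ {u v} → A u v ≡ true → B u v ≡ true) → Walk A u v → Walk B u v
mapʷ f (arc e)  = arc (f e)
mapʷ f (e ∷ʷ W) = f e ∷ʷ mapʷ f W

orient-acyclic : ∀ b {A : Digraph k} → Acyclic A → Acyclic (orient b A)
orient-acyclic false acyclic = acyclic
orient-acyclic true  acyclic v W = acyclic v (reverseʷ W)

module Layering {A : Digraph k} {B : Digraph l} (f : Fin k → Fin l)
  (rank : Fin k → ℕ) (reversed : ℕ → Bool)
  (rank-mono : ∀ {u v} → A u v ≡ true → rank u ≤ rank v)
  (in-layer  : ∀ {u v} → A u v ≡ true → rank u ≡ rank v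
             → orient (reversed (rank u)) B (f u) (f v) ≡ true)
  where

  rank-monoʷ : Walk A u v → rank u ≤ rank v
  rank-monoʷ (arc e)  = rank-mono e
  rank-monoʷ (e ∷ʷ W) = ≤-trans (rank-mono e) (rank-monoʷ W)

  private
    step : ∀ {ℓ} → A u v ≡ true → rank u ≡ ℓ → rank v ≤ ℓ
         → orient (reversed ℓ) B (f u) (f v) ≡ true × rank v ≡ ℓ
    step {u = u} {v} e refl v≤ℓ = in-layer e (sym v≡ℓ) , v≡ℓ
      where
      v≡ℓ : rank v ≡ rank u
      v≡ℓ = ≤-antisym v≤ℓ (rank-mono e)

  walk-in-layer : ∀ {ℓ} → Walk A u w → rank u ≡ ℓ → rank w ≤ ℓ
                → Walk (orient (reversed ℓ) B) (f u) (f w)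
  walk-in-layer (arc e) u≡ℓ w≤ℓ = arc (proj₁ (step e u≡ℓ w≤ℓ))
  walk-in-layer (e ∷ʷ W) u≡ℓ w≤ℓ
    with step e u≡ℓ (≤-trans (rank-monoʷ W) w≤ℓ)
  ... | e′ , v≡ℓ = e′ ∷ʷ walk-in-layer W v≡ℓ w≤ℓ

  acyclic-by-layers : Acyclic B → Acyclic A
  acyclic-by-layers acyclic v W =
    orient-acyclic (reversed (rank v)) acyclic (f v) (walk-in-layer W refl ≤-refl)

invert-orient : {A : Digraph k} (F : List (Subset k)) → A u v ≡ true
              → orient (flipped F u v) (invert A F) u v ≡ true
invert-orient {u = u} {v} {A} F e with flipped F u v in f
... | false rewrite e | f = refl
... | true  rewrite e | f = ∨-zeroʳ _

invert-[]⊆ : {A : Digraph k} → invert A [] u v ≡ true → A u v ≡ true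
invert-[]⊆ {u = u} {v} {A} e with A u v
... | true = refl
... | false with A v u
...   | true  = e
...   | false = e

InvEq-1⇒¬Acyclic : {A : Digraph k} → InvEq A 1 → ¬ Acyclic A
InvEq-1⇒¬Acyclic {A = A} (_ , minimal) acyclic
  with minimal [] (λ v W → acyclic v (mapʷ (invert-[]⊆ {A = A}) W))
... | ()

module _ {A : Digraph k} {F : List (Subset k)} (decycling : Decycling A F) where

  private
    arcᵒ : ∀ {b} → A u v ≡ true → flipped F u v ≡ b → orient b (invert A F) u v ≡ true
    arcᵒ e refl = invert-orient {A = A} F e

  transitive-triangle-flips : A x y ≡ true → A y z ≡ true → A x z ≡ true
    → flipped F x y ≡ flipped F y z → flipped F x z ≡ flipped F x y
  transitive-triangle-flips {x = x} {y} {z} xy yz xz same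
    with flipped F x z ≟ᵇ flipped F x y
  ... | yes agree = agree
  ... | no disagree =
    ⊥-elim (orient-acyclic b decycling x
      (arcᵒ xy refl ∷ʷ (arcᵒ yz (sym same) ∷ʷ arc (orient-not b (arcᵒ xz (¬-not disagree))))))
    where b = flipped F x y

  ¬alternating-square : A x y ≡ true → A z y ≡ true → A z w ≡ true → A x w ≡ true
    → flipped F x y ≡ false → flipped F z y ≡ true
    → flipped F z w ≡ false → flipped F x w ≡ true → ⊥
  ¬alternating-square {x = x} xy zy zw xw f₁ f₂ f₃ f₄ =
    decycling x (arcᵒ xy f₁ ∷ʷ (arcᵒ zy f₂ ∷ʷ (arcᵒ zw f₃ ∷ʷ arc (arcᵒ xw f₄))))

Ty : Set
Ty = Bool × Bool

_≟ᵀ_ : (p q : Ty) → Dec (p ≡ q)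
_≟ᵀ_ = ≡-dec _≟ᵇ_ _≟ᵇ_

_·_ : Ty → Ty → Bool
(a , b) · (c , d) = (a ∧ c) xor (b ∧ d)

-- A record rather than Ty → Bool, so that all sets of types can be enumerated without
-- function extensionality.
record TypeSet : Set where
  constructor types
  field has₀₀ has₁₀ has₀₁ has₁₁ : Bool

has : TypeSet → Ty → Bool
has S (false , false) = TypeSet.has₀₀ S
has S (true  , false) = TypeSet.has₁₀ S
has S (false , true ) = TypeSet.has₀₁ S
has S (true  , true ) = TypeSet.has₁₁ S

_∋_ : TypeSet → Ty → Set
S ∋ p = T (has S p)

_∋?_ : ∀ S p → Dec (S ∋ p)
S ∋? p = T? (has S p)

tabulate : (Ty → Bool) → TypeSet
tabulate f = types (f (false , false)) (f (true , false)) (f (false , true)) (f (true , true))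

has-tabulate : ∀ f p → has (tabulate f) p ≡ f p
has-tabulate f (false , false) = refl
has-tabulate f (true  , false) = refl
has-tabulate f (false , true ) = refl
has-tabulate f (true  , true ) = refl

∀-Bool? : {P : Bool → Set} → (∀ b → Dec (P b)) → Dec (∀ b → P b)
∀-Bool? P? = map′ (λ (t , f) → λ { true → t ; false → f }) (λ h → h true , h false)
                  (P? true ×-dec P? false)

∃-Bool? : {P : Bool → Set} → (∀ b → Dec (P b)) → Dec (∃ P)
∃-Bool? P? = map′ [ (true ,_) , (false ,_) ] (λ { (true , p) → inj₁ p ; (false , p) → inj₂ p })
                  (P? true ⊎-dec P? false)

∀-Ty? : {P : Ty → Set} → (∀ p → Dec (P p)) → Dec (∀ p → P p)
∀-Ty? P? = map′ (λ h (a , b) → h a b) (λ h a b → h (a , b))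
                (∀-Bool? λ a → ∀-Bool? λ b → P? (a , b))

∃-Ty? : {P : Ty → Set} → (∀ p → Dec (P p)) → Dec (∃ P)
∃-Ty? P? = map′ (λ (a , b , p) → (a , b) , p) (λ ((a , b) , p) → a , b , p)
                (∃-Bool? λ a → ∃-Bool? λ b → P? (a , b))

∀-TypeSet? : {P : TypeSet → Set} → (∀ S → Dec (P S)) → Dec (∀ S → P S)
∀-TypeSet? P? = map′ (λ h (types a b c d) → h a b c d) (λ h a b c d → h (types a b c d))
  (∀-Bool? λ a → ∀-Bool? λ b → ∀-Bool? λ c → ∀-Bool? λ d → P? (types a b c d))

_avoids_ : TypeSet → (Ty → Bool) → Set
S avoids π = ∀ p → S ∋ p → π p ≡ false

_avoids?_ : ∀ S π → Dec (S avoids π)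
S avoids? π = ∀-Ty? λ p → (S ∋? p) →-dec (π p ≟ᵇ false)

Separated : TypeSet → TypeSet → Set
Separated Sᴸ Sᴿ = (Sᴸ avoids proj₂ × Sᴿ avoids proj₁) ⊎ (Sᴸ avoids proj₁ × Sᴿ avoids proj₂)

AlternatingSquare : TypeSet → TypeSet → Set
AlternatingSquare Sᴸ Sᴿ = ∃[ p₁ ] ∃[ p₂ ] ∃[ t₁ ] ∃[ t₂ ]
  (Sᴸ ∋ p₁ × Sᴸ ∋ p₂ × Sᴿ ∋ t₁ × Sᴿ ∋ t₂ ×
   p₁ · t₁ ≡ false × p₂ · t₁ ≡ true × p₂ · t₂ ≡ false × p₁ · t₂ ≡ true)

alternatingSquare? : ∀ Sᴸ Sᴿ → Dec (AlternatingSquare Sᴸ Sᴿ)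
alternatingSquare? Sᴸ Sᴿ = ∃-Ty? λ p₁ → ∃-Ty? λ p₂ → ∃-Ty? λ t₁ → ∃-Ty? λ t₂ →
  Sᴸ ∋? p₁ ×-dec Sᴸ ∋? p₂ ×-dec Sᴿ ∋? t₁ ×-dec Sᴿ ∋? t₂ ×-dec
  p₁ · t₁ ≟ᵇ false ×-dec p₂ · t₁ ≟ᵇ true ×-dec p₂ · t₂ ≟ᵇ false ×-dec p₁ · t₂ ≟ᵇ true

-- What the transitive triangles formed by an arc of L of types p → q with a vertex of R of
-- type t (resp. a vertex of L of type s with an arc of R of types p → q) force on the types.
CompatibleᴸArc : TypeSet → Ty → Ty → Set
CompatibleᴸArc Sᴿ p q = ∀ t → Sᴿ ∋ t → p · q ≡ q · t → p · t ≡ p · q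

CompatibleᴿArc : TypeSet → Ty → Ty → Set
CompatibleᴿArc Sᴸ p q = ∀ s → Sᴸ ∋ s → s · p ≡ p · q → s · q ≡ s · p

compatibleᴸArc? : ∀ Sᴿ p q → Dec (CompatibleᴸArc Sᴿ p q)
compatibleᴸArc? Sᴿ p q = ∀-Ty? λ t → (Sᴿ ∋? t) →-dec ((p · q ≟ᵇ q · t) →-dec (p · t ≟ᵇ p · q))

compatibleᴿArc? : ∀ Sᴸ p q → Dec (CompatibleᴿArc Sᴸ p q)
compatibleᴿArc? Sᴸ p q = ∀-Ty? λ s → (Sᴸ ∋? s) →-dec ((s · p ≟ᵇ p · q) →-dec (s · q ≟ᵇ s · p))

Layered : TypeSet → (Ty → Ty → Set) → (Ty → ℕ) → (ℕ → Bool) → Set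
Layered S Compatible rank reversed = ∀ p q → S ∋ p → S ∋ q → Compatible p q
  → rank p ≤ rank q × (rank p ≡ rank q → p · q ≡ reversed (rank p))

layered? : ∀ S {C} → (∀ p q → Dec (C p q)) → ∀ rank reversed → Dec (Layered S C rank reversed)
layered? S C? rank reversed = ∀-Ty? λ p → ∀-Ty? λ q →
  (S ∋? p) →-dec ((S ∋? q) →-dec (C? p q →-dec
    (rank p ≤? rank q ×-dec (rank p ≟ⁿ rank q →-dec (p · q ≟ᵇ reversed (rank p))))))

-- Found by exhaustive search; a layer is reversed exactly when its types p have p · p = 1.
rankᴸ : Ty → ℕ
rankᴸ (true  , false) = 1
rankᴸ (false , true ) = 2
rankᴸ _               = 0

reversedᴸ : ℕ → Bool
reversedᴸ zero    = false
reversedᴸ (suc _) = true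

rankᴿ : Ty → ℕ
rankᴿ (true  , true ) = 0
rankᴿ (false , false) = 2
rankᴿ _               = 1

reversedᴿ : ℕ → Bool
reversedᴿ 1 = true
reversedᴿ _ = false

Classified : TypeSet → TypeSet → Set
Classified Sᴸ Sᴿ
  = Separated Sᴸ Sᴿ
  ⊎ AlternatingSquare Sᴸ Sᴿ
  ⊎ Layered Sᴸ (CompatibleᴸArc Sᴿ) rankᴸ reversedᴸ
  ⊎ Layered Sᴸ (CompatibleᴸArc Sᴿ) (rankᴸ ∘ swap) reversedᴸ
  ⊎ Layered Sᴿ (CompatibleᴿArc Sᴸ) rankᴿ reversedᴿ

classified? : ∀ Sᴸ Sᴿ → Dec (Classified Sᴸ Sᴿ)
classified? Sᴸ Sᴿ =
  ((Sᴸ avoids? proj₂ ×-dec Sᴿ avoids? proj₁) ⊎-dec (Sᴸ avoids? proj₁ ×-dec Sᴿ avoids? proj₂))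
  ⊎-dec alternatingSquare? Sᴸ Sᴿ
  ⊎-dec layered? Sᴸ (compatibleᴸArc? Sᴿ) rankᴸ reversedᴸ
  ⊎-dec layered? Sᴸ (compatibleᴸArc? Sᴿ) (rankᴸ ∘ swap) reversedᴸ
  ⊎-dec layered? Sᴿ (compatibleᴿArc? Sᴸ) rankᴿ reversedᴿ

classify : ∀ Sᴸ Sᴿ → Classified Sᴸ Sᴿ
classify = from-yes (∀-TypeSet? λ Sᴸ → ∀-TypeSet? λ Sᴿ → classified? Sᴸ Sᴿ)

module _ {m n : ℕ} (L : Digraph m) (R : Digraph n) where

  dijoin-↑ˡ : ∀ i j → dijoin L R (i ↑ˡ n) (j ↑ˡ n) ≡ L i j
  dijoin-↑ˡ i j rewrite splitAt-↑ˡ m i n | splitAt-↑ˡ m j n = refl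

  dijoin-↑ʳ : ∀ i j → dijoin L R (m ↑ʳ i) (m ↑ʳ j) ≡ R i j
  dijoin-↑ʳ i j rewrite splitAt-↑ʳ m n i | splitAt-↑ʳ m n j = refl

  dijoin-↑ˡ↑ʳ : ∀ i j → dijoin L R (i ↑ˡ n) (m ↑ʳ j) ≡ true
  dijoin-↑ˡ↑ʳ i j rewrite splitAt-↑ˡ m i n | splitAt-↑ʳ m n j = refl

module Dijoin (m n : ℕ) (L : Digraph m) (R : Digraph n) (X₁ X₂ : Subset (m + n))
  (decycling : Decycling (dijoin L R) (X₁ ∷ X₂ ∷ [])) where

  private
    D = dijoin L R
    F = X₁ ∷ X₂ ∷ []

  type : Fin (m + n) → Ty
  type x = lookup X₁ x , lookup X₂ x

  flipped-type : ∀ x y → flipped F x y ≡ type x · type y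
  flipped-type x y = cong (lookup X₁ x ∧ lookup X₁ y xor_) (xor-identityʳ _)

  occurs? : (e : Fin k → Fin (m + n)) → ∀ p → Dec (∃ λ i → type (e i) ≡ p)
  occurs? e p = any? λ i → type (e i) ≟ᵀ p

  typesOf : (Fin k → Fin (m + n)) → TypeSet
  typesOf e = tabulate (isYes ∘ occurs? e)

  typesOf-complete : (e : Fin k → Fin (m + n)) → ∀ i → typesOf e ∋ type (e i)
  typesOf-complete e i =
    subst T (sym (has-tabulate (isYes ∘ occurs? e) (type (e i))))
      (fromWitness {a? = occurs? e (type (e i))} (i , refl))

  typesOf-sound : (e : Fin k → Fin (m + n)) → ∀ p → typesOf e ∋ p → ∃ λ i → type (e i) ≡ p
  typesOf-sound e p p∈ =
    toWitness {a? = occurs? e p} (subst T (has-tabulate (isYes ∘ occurs? e) p) p∈)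

  typesᴸ typesᴿ : TypeSet
  typesᴸ = typesOf (_↑ˡ n)
  typesᴿ = typesOf (m ↑ʳ_)

  private
    flipped≡ : ∀ {x y b} → type x · type y ≡ b → flipped F x y ≡ b
    flipped≡ {x} {y} = trans (flipped-type x y)

  ¬AlternatingSquare-types : ¬ AlternatingSquare typesᴸ typesᴿ
  ¬AlternatingSquare-types (p₁ , p₂ , t₁ , t₂ , p₁∈ , p₂∈ , t₁∈ , t₂∈ , f₁ , f₂ , f₃ , f₄)
    with typesOf-sound (_↑ˡ n) p₁ p₁∈ | typesOf-sound (_↑ˡ n) p₂ p₂∈
       | typesOf-sound (m ↑ʳ_) t₁ t₁∈ | typesOf-sound (m ↑ʳ_) t₂ t₂∈
  ... | i₁ , refl | i₂ , refl | j₁ , refl | j₂ , refl =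
    ¬alternating-square {A = D} {F = F} decycling
      (dijoin-↑ˡ↑ʳ L R i₁ j₁) (dijoin-↑ˡ↑ʳ L R i₂ j₁) (dijoin-↑ˡ↑ʳ L R i₂ j₂) (dijoin-↑ˡ↑ʳ L R i₁ j₂)
      (flipped≡ f₁) (flipped≡ f₂) (flipped≡ f₃) (flipped≡ f₄)

  private
    triangleᵀ : D x y ≡ true → D y z ≡ true → D x z ≡ true
      → type x · type y ≡ type y · type z → type x · type z ≡ type x · type y
    triangleᵀ {x = x} {y} {z} xy yz xz same = begin
      type x · type z  ≡⟨ sym (flipped-type x z) ⟩
      flipped F x z    ≡⟨ transitive-triangle-flips {A = D} {F = F} decycling xy yz xz
                            (flipped≡ (trans same (sym (flipped-type y z)))) ⟩
      flipped F x y    ≡⟨ flipped-type x y ⟩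
      type x · type y  ∎
      where open ≡-Reasoning

  compatibleᴸ : ∀ {i i′} → L i i′ ≡ true → CompatibleᴸArc typesᴿ (type (i ↑ˡ n)) (type (i′ ↑ˡ n))
  compatibleᴸ {i} {i′} a t t∈ same with typesOf-sound (m ↑ʳ_) t t∈
  ... | j , refl =
    triangleᵀ (trans (dijoin-↑ˡ L R i i′) a) (dijoin-↑ˡ↑ʳ L R i′ j) (dijoin-↑ˡ↑ʳ L R i j) same

  compatibleᴿ : ∀ {j j′} → R j j′ ≡ true → CompatibleᴿArc typesᴸ (type (m ↑ʳ j)) (type (m ↑ʳ j′))
  compatibleᴿ {j} {j′} a s s∈ same with typesOf-sound (_↑ˡ n) s s∈
  ... | i , refl =
    triangleᵀ (dijoin-↑ˡ↑ʳ L R i j) (trans (dijoin-↑ʳ L R j j′) a) (dijoin-↑ˡ↑ʳ L R i j′) same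

  layered⇒acyclic : {A : Digraph k} (e : Fin k → Fin (m + n)) {Compatible : Ty → Ty → Set}
    → (∀ u v → D (e u) (e v) ≡ A u v)
    → (∀ {u v} → A u v ≡ true → Compatible (type (e u)) (type (e v)))
    → ∀ rank reversed → Layered (typesOf e) Compatible rank reversed → Acyclic A
  layered⇒acyclic {A = A} e D≡A compatible rank reversed layered =
    Layering.acyclic-by-layers e (rank ∘ type ∘ e) reversed
      (λ a → proj₁ (bounds a)) in-layer decycling
    where
    bounds : ∀ {u v} → A u v ≡ true → rank (type (e u)) ≤ rank (type (e v))
      × (rank (type (e u)) ≡ rank (type (e v)) → type (e u) · type (e v) ≡ reversed (rank (type (e u))))
    bounds {u} {v} a = layered _ _ (typesOf-complete e u) (typesOf-complete e v) (compatible a)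
    in-layer : ∀ {u v} → A u v ≡ true → rank (type (e u)) ≡ rank (type (e v))
      → orient (reversed (rank (type (e u)))) (invert D F) (e u) (e v) ≡ true
    in-layer {u} {v} a same =
      subst (λ b → orient b (invert D F) (e u) (e v) ≡ true)
        (flipped≡ (proj₂ (bounds a) same)) (invert-orient {A = D} F (trans (D≡A u v) a))

  acyclicᴸ : ∀ rank reversed → Layered typesᴸ (CompatibleᴸArc typesᴿ) rank reversed → Acyclic L
  acyclicᴸ = layered⇒acyclic (_↑ˡ n) (dijoin-↑ˡ L R) compatibleᴸ

  acyclicᴿ : ∀ rank reversed → Layered typesᴿ (CompatibleᴿArc typesᴸ) rank reversed → Acyclic R
  acyclicᴿ = layered⇒acyclic (m ↑ʳ_) (dijoin-↑ʳ L R) compatibleᴿ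

  avoids⇒∉ : ∀ {X π} (e : Fin k → Fin (m + n)) → (∀ x → π (type x) ≡ lookup X x)
    → typesOf e avoids π → ∀ i → e i ∉ X
  avoids⇒∉ e πX avoidance i e∈X =
    case trans (sym ([]=⇒lookup e∈X)) (trans (sym (πX (e i))) (avoidance _ (typesOf-complete e i)))
    of λ ()

  ⊆VL-of : ∀ {X π} → (∀ x → π (type x) ≡ lookup X x) → typesᴿ avoids π → ⊆VL m n X
  ⊆VL-of {X} πX avoidance x x∈X with splitAt m x in split
  ... | inj₁ i = i , sym (splitAt⁻¹-↑ˡ split)
  ... | inj₂ j = ⊥-elim (avoids⇒∉ {X = X} (m ↑ʳ_) πX avoidance j
                          (subst (_∈ X) (sym (splitAt⁻¹-↑ʳ split)) x∈X))

  ⊆VR-of : ∀ {X π} → (∀ x → π (type x) ≡ lookup X x) → typesᴸ avoids π → ⊆VR m n X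
  ⊆VR-of {X} πX avoidance x x∈X with splitAt m x in split
  ... | inj₂ j = j , sym (splitAt⁻¹-↑ʳ split)
  ... | inj₁ i = ⊥-elim (avoids⇒∉ {X = X} (_↑ˡ n) πX avoidance i
                          (subst (_∈ X) (sym (splitAt⁻¹-↑ˡ split)) x∈X))

theorem3p3 : (m n : ℕ) (L : Digraph m) (R : Digraph n)
    → Oriented L → Oriented R → InvEq L 1 → InvEq R 1
    → (X₁ X₂ : Subset (m + n))
    → Decycling (dijoin L R) (X₁ ∷ X₂ ∷ [])
    → (⊆VL m n X₁ × ⊆VR m n X₂) ⊎ (⊆VR m n X₁ × ⊆VL m n X₂)
theorem3p3 m n L R _ _ invL invR X₁ X₂ decycling = conclude (classify typesᴸ typesᴿ)
  where
  open Dijoin m n L R X₁ X₂ decycling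
  conclude : Classified typesᴸ typesᴿ → (⊆VL m n X₁ × ⊆VR m n X₂) ⊎ (⊆VR m n X₁ × ⊆VL m n X₂)
  conclude (inj₁ (inj₁ (L∌₂ , R∌₁))) = inj₁ (⊆VL-of (λ _ → refl) R∌₁ , ⊆VR-of (λ _ → refl) L∌₂)
  conclude (inj₁ (inj₂ (L∌₁ , R∌₂))) = inj₂ (⊆VR-of (λ _ → refl) L∌₁ , ⊆VL-of (λ _ → refl) R∌₂)
  conclude (inj₂ (inj₁ square)) = ⊥-elim (¬AlternatingSquare-types square)
  conclude (inj₂ (inj₂ (inj₁ layered))) =
    ⊥-elim (InvEq-1⇒¬Acyclic invL (acyclicᴸ rankᴸ reversedᴸ layered))
  conclude (inj₂ (inj₂ (inj₂ (inj₁ layered)))) =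
    ⊥-elim (InvEq-1⇒¬Acyclic invL (acyclicᴸ (rankᴸ ∘ swap) reversedᴸ layered))
  conclude (inj₂ (inj₂ (inj₂ (inj₂ layered)))) =
    ⊥-elim (InvEq-1⇒¬Acyclic invR (acyclicᴿ rankᴿ reversedᴿ layered))
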